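{- Let $n\ge2$. The maximum value of $k$ such that there exists a $k$-th order sensitive Boolean function on $n$ variables with real polynomial degree less than $n$ is $n-1$ if $n$ is odd, and $n-2$ if $n$ is even.
   Context: Real polynomial degree: degree of the unique multilinear real polynomial agreeing with the function on $\{0,1\}^n$. For $S\subseteq[n]$, $\mathbf{x}^{(S)}$ is $\mathbf{x}$ with the bits in $S$ flipped; $f$ is $k$-th order sensitive if there is $\mathbf{x}$ with $f(\mathbf{x})\ne f(\mathbf{x}^{(S)})$ for all $S$ with $1\le|S|\le k$. -}

module Defs where

open import Data.Nat using (ℕ; zero; suc; _≤_; _∸_)
open import Data.Nat.Base using (_%_)
open import Data.Bool using (Bool; true; false; if_then_else_; _xor_)
open import Data.Vec using (Vec; []; _∷_; zipWith; _++_; map)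
open import Data.List using (List; []; _∷_; concatMap)
open import Data.Fin.Subset using (Subset; ∣_∣)
open import Data.Rational using (ℚ; 0ℚ; 1ℚ; _+_; _*_)
open import Data.Product using (Σ; ∃; _×_)
open import Relation.Binary.PropositionalEquality using (_≡_; _≢_)

BoolFun : ℕ → Set
BoolFun n = Vec Bool n → Bool

allVecs : (n : ℕ) → List (Vec Bool n)
allVecs zero = [] ∷ []
allVecs (suc n) = concatMap (λ v → (false ∷ v) ∷ (true ∷ v) ∷ []) (allVecs n)

b2q : Bool → ℚ
b2q false = 0ℚ
b2q true = 1ℚ

monomial : {n : ℕ} → Subset n → Vec Bool n → ℚ
monomial [] [] = 1ℚ
monomial (s ∷ S) (x ∷ xs) = (if s then b2q x else 1ℚ) * monomial S xs

sumL : {A : Set} → (A → ℚ) → List A → ℚ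
sumL g [] = 0ℚ
sumL g (a ∷ as) = g a + sumL g as

evalML : {n : ℕ} → (Subset n → ℚ) → Vec Bool n → ℚ
evalML {n} c x = sumL (λ S → c S * monomial S x) (allVecs n)

Represents : {n : ℕ} → (Subset n → ℚ) → BoolFun n → Set
Represents c f = ∀ x → evalML c x ≡ b2q (f x)

-- Real polynomial degree of f is less than d: the (unique) multilinear
-- polynomial agreeing with f on {0,1}^n has no monomial of degree ≥ d.
DegLessThan : {n : ℕ} → BoolFun n → ℕ → Set
DegLessThan {n} f d =
  Σ (Subset n → ℚ) λ c → Represents c f × (∀ S → d ≤ ∣ S ∣ → c S ≡ 0ℚ)

flipAt : {n : ℕ} → Vec Bool n → Subset n → Vec Bool n
flipAt x S = zipWith _xor_ x S

KthOrderSensitive : {n : ℕ} → ℕ → BoolFun n → Set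
KthOrderSensitive {n} k f =
  ∃ λ (x : Vec Bool n) → ∀ (S : Subset n) → 1 ≤ ∣ S ∣ → ∣ S ∣ ≤ k → f x ≢ f (flipAt x S)

maxOrder : ℕ → ℕ
maxOrder n with n % 2
... | 0 = n ∸ 2
... | _ = n ∸ 1

-- The coefficient of x₁⋯xₙ in the multilinear representation of f is the alternating sum
-- Σₓ (-1)^(number of zeros of x) · f x, so deg f < n exactly when f is balanced.
-- If f is k-th order sensitive at x, then f y ≠ f x for every y at Hamming distance 1, …, k
-- from x. Negating f if necessary, f x = 1, so for k ≥ n the function f is the indicator of {x},
-- and for k = n − 1 that of {x} or {x, ∁ x}; for even n the points x and ∁ x carry the same sign,
-- so in all these cases f is unbalanced. Conversely the indicator of {0, b} is balanced when 0
-- and b carry opposite signs and is sensitive at 0 of every order below |b|: take b = 1⋯1 for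
-- odd n and b = 01⋯1 for even n.

module Submission where

open import Defs
open import Data.Nat using (ℕ; zero; suc; _≤_; _<_; _∸_; _%_; z≤n; s≤s; parity)
open import Data.Nat.Properties using (_≤?_; _<?_; ≰⇒>; ≮⇒≥; ≤-antisym; ≤-trans; ≤-reflexive; <-≤-trans; ≤⇒≯; <⇒≢)
open import Data.Parity.Base using (0ℙ; 1ℙ; toSign)
open import Data.Sign.Base as Sign using (Sign; opposite)
open import Data.Sign.Properties using (opposite-involutive)
open import Data.Bool using (Bool; true; false; not; _∨_; _xor_)
import Data.Bool as Bool
open import Data.Bool.Properties using (not-injective; not-involutive; ¬-not)
open import Data.Vec using (Vec; []; _∷_; zipWith)
open import Data.Vec.Properties using (≡-dec)
open import Data.List using (List; []; _∷_; concatMap)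
open import Data.Fin.Subset using (Subset; ∣_∣; ⊤; ⊥; ∁)
open import Data.Fin.Subset.Properties using (∣p∣≤n; ∣⊥∣≡0; ∣⊤∣≡n; ∣p∣≡n⇒p≡⊤)
open import Data.Rational using (ℚ; 0ℚ; 1ℚ; _+_; _*_; -_; _-_)
import Data.Rational.Properties as ℚ
open import Data.Rational.Solver using (module +-*-Solver)
open +-*-Solver using (solve; _:+_; _:*_; :-_; _:-_; _:=_; con)
open import Data.Product using (Σ; ∃; _×_; _,_; proj₁; proj₂)
open import Data.Sum using (_⊎_; inj₁; inj₂; [_,_]′)
open import Function using (_∘_)
open import Relation.Nullary using (¬_; Dec; does; yes; no; contradiction)
open import Relation.Nullary.Decidable using (dec-true; dec-false)
open import Relation.Binary.PropositionalEquality

private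
  variable
    n k : ℕ

sumL-cong : ∀ {A : Set} {g h : A → ℚ} (L : List A) → (∀ a → g a ≡ h a) → sumL g L ≡ sumL h L
sumL-cong []      g≗h = refl
sumL-cong (a ∷ L) g≗h = cong₂ _+_ (g≗h a) (sumL-cong L g≗h)

sumL-zero : ∀ {A : Set} {g : A → ℚ} (L : List A) → (∀ a → g a ≡ 0ℚ) → sumL g L ≡ 0ℚ
sumL-zero []      g≡0 = refl
sumL-zero (a ∷ L) g≡0 = cong₂ _+_ (g≡0 a) (sumL-zero L g≡0)

sumL-concatMap-pair : ∀ {A B : Set} (h : B → ℚ) (p q : A → B) (L : List A) →
  sumL h (concatMap (λ a → p a ∷ q a ∷ []) L) ≡ sumL (λ a → h (p a) + h (q a)) L
sumL-concatMap-pair h p q []      = refl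
sumL-concatMap-pair h p q (a ∷ L) =
  trans (sym (ℚ.+-assoc (h (p a)) (h (q a)) _)) (cong (h (p a) + h (q a) +_) (sumL-concatMap-pair h p q L))

-- Σₓ (-1)^(number of zeros of x) · g x
alternatingSum : (n : ℕ) → (Vec Bool n → ℚ) → ℚ
alternatingSum zero    g = g []
alternatingSum (suc n) g = alternatingSum n (λ v → g (true ∷ v) - g (false ∷ v))

alternatingSum-cong : ∀ n {g h : Vec Bool n → ℚ} → g ≗ h → alternatingSum n g ≡ alternatingSum n h
alternatingSum-cong zero    g≗h = g≗h []
alternatingSum-cong (suc n) g≗h = alternatingSum-cong n (λ v → cong₂ _-_ (g≗h (true ∷ v)) (g≗h (false ∷ v)))

alternatingSum-zero : ∀ n → alternatingSum n (λ _ → 0ℚ) ≡ 0ℚ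
alternatingSum-zero zero    = refl
alternatingSum-zero (suc n) = alternatingSum-zero n

alternatingSum-+ : ∀ n (g h : Vec Bool n → ℚ) →
  alternatingSum n (λ v → g v + h v) ≡ alternatingSum n g + alternatingSum n h
alternatingSum-+ zero    g h = refl
alternatingSum-+ (suc n) g h =
  trans (alternatingSum-cong n (λ v → interchange (g (true ∷ v)) (h (true ∷ v)) (g (false ∷ v)) (h (false ∷ v))))
        (alternatingSum-+ n _ _)
  where
  interchange : ∀ a b c d → (a + b) - (c + d) ≡ (a - c) + (b - d)
  interchange = solve 4 (λ a b c d → (a :+ b) :- (c :+ d) := (a :- c) :+ (b :- d)) refl

alternatingSum-* : ∀ n a (g : Vec Bool n → ℚ) → alternatingSum n (λ v → a * g v) ≡ a * alternatingSum n g
alternatingSum-* zero    a g = refl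
alternatingSum-* (suc n) a g =
  trans (alternatingSum-cong n (λ v → distrib a (g (true ∷ v)) (g (false ∷ v)))) (alternatingSum-* n a _)
  where
  distrib : ∀ a x y → a * x - a * y ≡ a * (x - y)
  distrib = solve 3 (λ a x y → a :* x :- a :* y := a :* (x :- y)) refl

alternatingSum-neg : ∀ n (g : Vec Bool n → ℚ) → alternatingSum n (λ v → - g v) ≡ - alternatingSum n g
alternatingSum-neg zero    g = refl
alternatingSum-neg (suc n) g =
  trans (alternatingSum-cong n (λ v → neg-distrib (g (true ∷ v)) (g (false ∷ v)))) (alternatingSum-neg n _)
  where
  neg-distrib : ∀ x y → (- x) - (- y) ≡ - (x - y)
  neg-distrib = solve 2 (λ x y → (:- x) :- (:- y) := :- (x :- y)) refl

alternatingSum-- : ∀ n (g h : Vec Bool n → ℚ) →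
  alternatingSum n (λ v → g v - h v) ≡ alternatingSum n g - alternatingSum n h
alternatingSum-- n g h = trans (alternatingSum-+ n g (-_ ∘ h)) (cong (alternatingSum n g +_) (alternatingSum-neg n h))

alternatingSum-sumL : ∀ n {A : Set} (h : A → Vec Bool n → ℚ) (L : List A) →
  alternatingSum n (λ x → sumL (λ a → h a x) L) ≡ sumL (λ a → alternatingSum n (h a)) L
alternatingSum-sumL n h []      = alternatingSum-zero n
alternatingSum-sumL n h (a ∷ L) =
  trans (alternatingSum-+ n (h a) _) (cong (alternatingSum n (h a) +_) (alternatingSum-sumL n h L))

Balanced : BoolFun n → Set
Balanced {n} f = alternatingSum n (b2q ∘ f) ≡ 0ℚ

alternatingSum-monomial : (S : Subset n) → ∣ S ∣ < n → alternatingSum n (monomial S) ≡ 0ℚ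
alternatingSum-monomial {suc n} (true ∷ S) (s≤s ∣S∣<n) =
  trans (alternatingSum-cong n (λ v → drop-variable (monomial S v))) (alternatingSum-monomial S ∣S∣<n)
  where
  drop-variable : ∀ m → 1ℚ * m - 0ℚ * m ≡ m
  drop-variable = solve 1 (λ m → con 1ℚ :* m :- con 0ℚ :* m := m) refl
alternatingSum-monomial {suc n} (false ∷ S) _ =
  trans (alternatingSum-cong n (λ v → ℚ.+-inverseʳ (1ℚ * monomial S v))) (alternatingSum-zero n)

degLessThan⇒balanced : {f : BoolFun n} → DegLessThan f n → Balanced f
degLessThan⇒balanced {n} {f} (c , represents , c-high≡0) = begin
  alternatingSum n (b2q ∘ f)                                  ≡⟨ alternatingSum-cong n (sym ∘ represents) ⟩
  alternatingSum n (evalML c)                                 ≡⟨ alternatingSum-sumL n (λ S x → c S * monomial S x) (allVecs n) ⟩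
  sumL (λ S → alternatingSum n (λ x → c S * monomial S x)) (allVecs n)
                                                              ≡⟨ sumL-zero (allVecs n) term≡0 ⟩
  0ℚ                                                          ∎
  where
  open ≡-Reasoning
  term≡0 : ∀ S → alternatingSum n (λ x → c S * monomial S x) ≡ 0ℚ
  term≡0 S with ∣ S ∣ <? n
  ... | yes ∣S∣<n = trans (alternatingSum-* n (c S) (monomial S))
                          (trans (cong (c S *_) (alternatingSum-monomial S ∣S∣<n)) (ℚ.*-zeroʳ (c S)))
  ... | no ∣S∣≮n  = trans (alternatingSum-* n (c S) (monomial S))
                          (trans (cong (_* _) (c-high≡0 S (≮⇒≥ ∣S∣≮n))) (ℚ.*-zeroˡ (alternatingSum n (monomial S))))

-- Mirrors g (b ∷ v) = g (false ∷ v) + b · (g (true ∷ v) − g (false ∷ v)).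
consCoefficients : (Subset n → ℚ) → (Subset n → ℚ) → Subset (suc n) → ℚ
consCoefficients c₀ c₁ (false ∷ S) = c₀ S
consCoefficients c₀ c₁ (true ∷ S)  = c₁ S - c₀ S

evalML-consCoefficients : (c₀ c₁ : Subset n → ℚ) (v : Vec Bool n) →
  evalML (consCoefficients c₀ c₁) (false ∷ v) ≡ evalML c₀ v × evalML (consCoefficients c₀ c₁) (true ∷ v) ≡ evalML c₁ v
evalML-consCoefficients {n} c₀ c₁ v =
    trans (split false) (sumL-cong (allVecs n) (λ S → at-false (c₀ S) (c₁ S) (monomial S v)))
  , trans (split true) (sumL-cong (allVecs n) (λ S → at-true (c₀ S) (c₁ S) (monomial S v)))
  where
  c : Subset (suc n) → ℚ
  c = consCoefficients c₀ c₁
  split : ∀ b → evalML c (b ∷ v) ≡ sumL (λ S → c (false ∷ S) * monomial (false ∷ S) (b ∷ v)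
                                              + c (true ∷ S) * monomial (true ∷ S) (b ∷ v)) (allVecs n)
  split b = sumL-concatMap-pair (λ S → c S * monomial S (b ∷ v)) (false ∷_) (true ∷_) (allVecs n)
  at-false : ∀ a₀ a₁ m → a₀ * (1ℚ * m) + (a₁ - a₀) * (0ℚ * m) ≡ a₀ * m
  at-false = solve 3 (λ a₀ a₁ m → a₀ :* (con 1ℚ :* m) :+ (a₁ :- a₀) :* (con 0ℚ :* m) := a₀ :* m) refl
  at-true : ∀ a₀ a₁ m → a₀ * (1ℚ * m) + (a₁ - a₀) * (1ℚ * m) ≡ a₁ * m
  at-true = solve 3 (λ a₀ a₁ m → a₀ :* (con 1ℚ :* m) :+ (a₁ :- a₀) :* (con 1ℚ :* m) := a₁ :* m) refl

multilinearRepresentation : ∀ n (g : Vec Bool n → ℚ) →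
  Σ (Subset n → ℚ) λ c → (∀ x → evalML c x ≡ g x) × c ⊤ ≡ alternatingSum n g
multilinearRepresentation zero g = (λ _ → g []) , (λ { [] → trans (ℚ.+-identityʳ _) (ℚ.*-identityʳ (g [])) }) , refl
multilinearRepresentation (suc n) g
  with multilinearRepresentation n (g ∘ (false ∷_)) | multilinearRepresentation n (g ∘ (true ∷_))
... | c₀ , represents₀ , top₀ | c₁ , represents₁ , top₁ = consCoefficients c₀ c₁ , represents , top
  where
  represents : ∀ x → evalML (consCoefficients c₀ c₁) x ≡ g x
  represents (false ∷ v) = trans (proj₁ (evalML-consCoefficients c₀ c₁ v)) (represents₀ v)
  represents (true ∷ v)  = trans (proj₂ (evalML-consCoefficients c₀ c₁ v)) (represents₁ v)
  top : c₁ ⊤ - c₀ ⊤ ≡ alternatingSum (suc n) g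
  top = trans (cong₂ _-_ top₁ top₀) (sym (alternatingSum-- n (g ∘ (true ∷_)) (g ∘ (false ∷_))))

balanced⇒degLessThan : {f : BoolFun n} → Balanced f → DegLessThan f n
balanced⇒degLessThan {n} {f} balanced with multilinearRepresentation n (b2q ∘ f)
... | c , represents , top = c , represents , c-high≡0
  where
  c-high≡0 : ∀ S → n ≤ ∣ S ∣ → c S ≡ 0ℚ
  c-high≡0 S n≤∣S∣ = trans (cong c (∣p∣≡n⇒p≡⊤ (≤-antisym (∣p∣≤n S) n≤∣S∣))) (trans top balanced)

sign : Vec Bool n → Sign
sign []          = Sign.+
sign (true ∷ x)  = sign x
sign (false ∷ x) = opposite (sign x)

sign-⊤ : ∀ n → sign (⊤ {n}) ≡ Sign.+
sign-⊤ zero    = refl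
sign-⊤ (suc n) = sign-⊤ n

sign-⊥ : ∀ n → sign (⊥ {n}) ≡ toSign (parity n)
sign-⊥ zero          = refl
sign-⊥ (suc zero)    = refl
sign-⊥ (suc (suc n)) = trans (opposite-involutive (sign (⊥ {n}))) (sign-⊥ n)

sign-∁ : parity n ≡ 0ℙ → (x : Vec Bool n) → sign (∁ x) ≡ sign x
sign-∁ even [] = refl
sign-∁ even (true ∷ true ∷ x)   = trans (opposite-involutive _) (sign-∁ even x)
sign-∁ even (true ∷ false ∷ x)  = cong opposite (sign-∁ even x)
sign-∁ even (false ∷ true ∷ x)  = cong opposite (sign-∁ even x)
sign-∁ even (false ∷ false ∷ x) = trans (sign-∁ even x) (sym (opposite-involutive _))

signℚ : Sign → ℚ
signℚ Sign.+ = 1ℚ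
signℚ Sign.- = - 1ℚ

signℚ-opposite : ∀ s → signℚ (opposite s) ≡ - signℚ s
signℚ-opposite Sign.+ = refl
signℚ-opposite Sign.- = refl

signℚ+signℚ-opposite : ∀ s → signℚ s + signℚ (opposite s) ≡ 0ℚ
signℚ+signℚ-opposite Sign.+ = refl
signℚ+signℚ-opposite Sign.- = refl

signℚ≢0 : ∀ s → signℚ s ≢ 0ℚ
signℚ≢0 Sign.+ ()
signℚ≢0 Sign.- ()

signℚ+signℚ≢0 : ∀ s → signℚ s + signℚ s ≢ 0ℚ
signℚ+signℚ≢0 Sign.+ ()
signℚ+signℚ≢0 Sign.- ()

_≟_ : (x y : Vec Bool n) → Dec (x ≡ y)
_≟_ = ≡-dec Bool._≟_

point : Vec Bool n → BoolFun n
point x y = does (x ≟ y)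

pair : Vec Bool n → Vec Bool n → BoolFun n
pair a b y = point a y ∨ point b y

alternatingSum-point : (x : Vec Bool n) → alternatingSum n (b2q ∘ point x) ≡ signℚ (sign x)
alternatingSum-point [] = refl
alternatingSum-point {suc n} (true ∷ x) =
  trans (alternatingSum-cong n (λ v → ℚ.+-identityʳ (b2q (point x v)))) (alternatingSum-point x)
alternatingSum-point {suc n} (false ∷ x) = begin
  alternatingSum n (λ v → 0ℚ - b2q (point x v)) ≡⟨ alternatingSum-cong n (λ v → ℚ.+-identityˡ (- b2q (point x v))) ⟩
  alternatingSum n (λ v → - b2q (point x v))    ≡⟨ alternatingSum-neg n (b2q ∘ point x) ⟩
  - alternatingSum n (b2q ∘ point x)            ≡⟨ cong -_ (alternatingSum-point x) ⟩
  - signℚ (sign x)                              ≡⟨ signℚ-opposite (sign x) ⟨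
  signℚ (opposite (sign x))                     ∎
  where open ≡-Reasoning

b2q-pair : {a b : Vec Bool n} → a ≢ b → ∀ y → b2q (pair a b y) ≡ b2q (point a y) + b2q (point b y)
b2q-pair {a = a} {b} a≢b y with a ≟ y | b ≟ y
... | yes refl | yes refl = contradiction refl a≢b
... | yes _    | no _     = refl
... | no _     | yes _    = refl
... | no _     | no _     = refl

alternatingSum-pair : {a b : Vec Bool n} → a ≢ b →
  alternatingSum n (b2q ∘ pair a b) ≡ signℚ (sign a) + signℚ (sign b)
alternatingSum-pair {n} {a} {b} a≢b =
  trans (alternatingSum-cong n (b2q-pair a≢b))
        (trans (alternatingSum-+ n _ _) (cong₂ _+_ (alternatingSum-point a) (alternatingSum-point b)))

Balanced-cong : {f g : BoolFun n} → f ≗ g → Balanced f → Balanced g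
Balanced-cong {n} f≗g = trans (sym (alternatingSum-cong n (cong b2q ∘ f≗g)))

balanced-not : {f : BoolFun (suc n)} → Balanced f → Balanced (not ∘ f)
balanced-not {n} {f} balanced = begin
  alternatingSum n (λ v → b2q (not (f (true ∷ v))) - b2q (not (f (false ∷ v))))
    ≡⟨ alternatingSum-cong n (λ v → complement (f (true ∷ v)) (f (false ∷ v))) ⟩
  alternatingSum n (λ v → - (b2q (f (true ∷ v)) - b2q (f (false ∷ v))))
    ≡⟨ alternatingSum-neg n _ ⟩
  - alternatingSum (suc n) (b2q ∘ f)
    ≡⟨ cong -_ balanced ⟩
  0ℚ ∎
  where
  open ≡-Reasoning
  b2q-not : ∀ b → b2q (not b) ≡ 1ℚ - b2q b
  b2q-not true  = refl
  b2q-not false = refl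
  complement : ∀ a b → b2q (not a) - b2q (not b) ≡ - (b2q a - b2q b)
  complement a b = trans (cong₂ _-_ (b2q-not a) (b2q-not b))
    (solve 2 (λ p q → (con 1ℚ :- p) :- (con 1ℚ :- q) := :- (p :- q)) refl (b2q a) (b2q b))

point-unbalanced : (x : Vec Bool n) → ¬ Balanced (point x)
point-unbalanced x balanced = signℚ≢0 (sign x) (trans (sym (alternatingSum-point x)) balanced)

pair-unbalanced : {a b : Vec Bool n} → a ≢ b → sign b ≡ sign a → ¬ Balanced (pair a b)
pair-unbalanced {a = a} a≢b sign-b≡sign-a balanced =
  signℚ+signℚ≢0 (sign a)
    (trans (cong (λ s → signℚ (sign a) + signℚ s) (sym sign-b≡sign-a)) (trans (sym (alternatingSum-pair a≢b)) balanced))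

pair-balanced : {a b : Vec Bool n} → a ≢ b → sign b ≡ opposite (sign a) → Balanced (pair a b)
pair-balanced {a = a} a≢b sign-b≡opposite =
  trans (alternatingSum-pair a≢b)
        (trans (cong (λ s → signℚ (sign a) + signℚ s) sign-b≡opposite) (signℚ+signℚ-opposite (sign a)))

SensitiveAt : ℕ → BoolFun n → Vec Bool n → Set
SensitiveAt {n} k f x = ∀ (S : Subset n) → 1 ≤ ∣ S ∣ → ∣ S ∣ ≤ k → f x ≢ f (flipAt x S)

sensitiveAt-not : {f : BoolFun n} {x : Vec Bool n} → SensitiveAt k f x → SensitiveAt k (not ∘ f) x
sensitiveAt-not sensitive S 1≤∣S∣ ∣S∣≤k = sensitive S 1≤∣S∣ ∣S∣≤k ∘ not-injective

difference : Vec Bool n → Vec Bool n → Subset n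
difference = zipWith _xor_

flipAt-difference : (x y : Vec Bool n) → flipAt x (difference x y) ≡ y
flipAt-difference []          []      = refl
flipAt-difference (true ∷ x)  (b ∷ y) = cong₂ _∷_ (not-involutive b) (flipAt-difference x y)
flipAt-difference (false ∷ x) (b ∷ y) = cong (b ∷_) (flipAt-difference x y)

flipAt-⊤ : (x : Vec Bool n) → flipAt x ⊤ ≡ ∁ x
flipAt-⊤ []          = refl
flipAt-⊤ (true ∷ x)  = cong (false ∷_) (flipAt-⊤ x)
flipAt-⊤ (false ∷ x) = cong (true ∷_) (flipAt-⊤ x)

flipAt-⊥ : (S : Subset n) → flipAt ⊥ S ≡ S
flipAt-⊥ []      = refl
flipAt-⊥ (s ∷ S) = cong (s ∷_) (flipAt-⊥ S)

∣difference∣>0 : (x y : Vec Bool n) → x ≢ y → 0 < ∣ difference x y ∣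
∣difference∣>0 []          []          x≢y = contradiction refl x≢y
∣difference∣>0 (true ∷ x)  (false ∷ y) _   = s≤s z≤n
∣difference∣>0 (false ∷ x) (true ∷ y)  _   = s≤s z≤n
∣difference∣>0 (true ∷ x)  (true ∷ y)  x≢y = ∣difference∣>0 x y (x≢y ∘ cong (true ∷_))
∣difference∣>0 (false ∷ x) (false ∷ y) x≢y = ∣difference∣>0 x y (x≢y ∘ cong (false ∷_))

x≢∁x : (x : Vec Bool (suc n)) → x ≢ ∁ x
x≢∁x (true ∷ x) ()
x≢∁x (false ∷ x) ()

sensitiveAt-levelSet : {f : BoolFun n} {x y : Vec Bool n} → SensitiveAt k f x →
  f y ≡ f x → y ≡ x ⊎ k < ∣ difference x y ∣
sensitiveAt-levelSet {k = k} {f = f} {x} {y} sensitive fy≡fx with x ≟ y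
... | yes x≡y = inj₁ (sym x≡y)
... | no x≢y with k <? ∣ difference x y ∣
...   | yes k<∣d∣ = inj₂ k<∣d∣
...   | no k≮∣d∣  = contradiction (sym (trans (cong f (flipAt-difference x y)) fy≡fx))
                                  (sensitive (difference x y) (∣difference∣>0 x y x≢y) (≮⇒≥ k≮∣d∣))

sensitiveAt-levelSet-point : {f : BoolFun n} {x y : Vec Bool n} → SensitiveAt k f x → n ≤ k →
  f y ≡ f x → y ≡ x
sensitiveAt-levelSet-point {x = x} {y} sensitive n≤k fy≡fx with sensitiveAt-levelSet sensitive fy≡fx
... | inj₁ y≡x   = y≡x
... | inj₂ k<∣d∣ = contradiction (<-≤-trans k<∣d∣ (∣p∣≤n (difference x y))) (≤⇒≯ n≤k)

sensitiveAt-levelSet-antipodal : {f : BoolFun n} {x y : Vec Bool n} → SensitiveAt k f x → n ≤ suc k →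
  f y ≡ f x → y ≡ x ⊎ y ≡ ∁ x
sensitiveAt-levelSet-antipodal {n} {x = x} {y} sensitive n≤1+k fy≡fx with sensitiveAt-levelSet sensitive fy≡fx
... | inj₁ y≡x   = inj₁ y≡x
... | inj₂ k<∣d∣ = inj₂ (begin
  y                             ≡⟨ flipAt-difference x y ⟨
  flipAt x (difference x y)     ≡⟨ cong (flipAt x) (∣p∣≡n⇒p≡⊤ (≤-antisym (∣p∣≤n (difference x y)) (≤-trans n≤1+k k<∣d∣))) ⟩
  flipAt x ⊤                    ≡⟨ flipAt-⊤ x ⟩
  ∁ x                           ∎)
  where open ≡-Reasoning

≗-point : {f : BoolFun n} {x : Vec Bool n} → f x ≡ true → (∀ y → f y ≡ true → y ≡ x) → f ≗ point x
≗-point {x = x} fx≡true only-x y with x ≟ y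
... | yes refl = fx≡true
... | no x≢y   = ¬-not (x≢y ∘ sym ∘ only-x y)

≗-pair : {f : BoolFun n} {a b : Vec Bool n} → f a ≡ true → f b ≡ true →
  (∀ y → f y ≡ true → y ≡ a ⊎ y ≡ b) → f ≗ pair a b
≗-pair {a = a} {b} fa≡true fb≡true only-a-b y with a ≟ y | b ≟ y
... | yes refl | _        = fa≡true
... | no _     | yes refl = fb≡true
... | no a≢y   | no b≢y   = ¬-not ([ a≢y ∘ sym , b≢y ∘ sym ]′ ∘ only-a-b y)

sensitiveAt-balanced-wlog : {A : Set} {f : BoolFun (suc n)} {x : Vec Bool (suc n)} →
  (∀ {g : BoolFun (suc n)} → SensitiveAt k g x → Balanced g → g x ≡ true → A) →
  SensitiveAt k f x → Balanced f → A
sensitiveAt-balanced-wlog {f = f} {x} normalised sensitive balanced with f x Bool.≟ true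
... | yes fx≡true = normalised {f} sensitive balanced fx≡true
... | no fx≢true  = normalised {not ∘ f} (sensitiveAt-not {f = f} sensitive) (balanced-not {f = f} balanced) (cong not (¬-not fx≢true))

sensitiveAt∧balanced⇒k≤n : {f : BoolFun (suc n)} {x : Vec Bool (suc n)} →
  SensitiveAt k f x → Balanced f → k ≤ n
sensitiveAt∧balanced⇒k≤n {n} {k} {f} {x} = sensitiveAt-balanced-wlog {f = f} {x} (λ {g} → bound {g})
  where
  bound : {g : BoolFun (suc n)} → SensitiveAt k g x → Balanced g → g x ≡ true → k ≤ n
  bound {g} sensitive balanced gx≡true with k ≤? n
  ... | yes k≤n = k≤n
  ... | no k≰n  = contradiction (Balanced-cong (≗-point {f = g} gx≡true levelSet) balanced) (point-unbalanced x)
    where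
    levelSet : ∀ y → g y ≡ true → y ≡ x
    levelSet y gy≡true = sensitiveAt-levelSet-point sensitive (≰⇒> k≰n) (trans gy≡true (sym gx≡true))

sensitiveAt∧balanced⇒k≤n-even : parity n ≡ 0ℙ → {f : BoolFun (suc (suc n))} {x : Vec Bool (suc (suc n))} →
  SensitiveAt k f x → Balanced f → k ≤ n
sensitiveAt∧balanced⇒k≤n-even {n} {k} even {f} {x} = sensitiveAt-balanced-wlog {f = f} {x} (λ {g} → bound {g})
  where
  bound : {g : BoolFun (suc (suc n))} → SensitiveAt k g x → Balanced g → g x ≡ true → k ≤ n
  bound {g} sensitive balanced gx≡true with k ≤? n
  ... | yes k≤n = k≤n
  ... | no k≰n  with g (∁ x) in g∁x
  ...   | true  = contradiction (Balanced-cong (≗-pair {f = g} gx≡true g∁x levelSet) balanced)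
                                (pair-unbalanced (x≢∁x x) (sign-∁ even x))
    where
    levelSet : ∀ y → g y ≡ true → y ≡ x ⊎ y ≡ ∁ x
    levelSet y gy≡true = sensitiveAt-levelSet-antipodal sensitive (s≤s (≰⇒> k≰n)) (trans gy≡true (sym gx≡true))
  ...   | false = contradiction (Balanced-cong (≗-point {f = g} gx≡true levelSet) balanced) (point-unbalanced x)
    where
    levelSet : ∀ y → g y ≡ true → y ≡ x
    levelSet y gy≡true with sensitiveAt-levelSet-antipodal sensitive (s≤s (≰⇒> k≰n)) (trans gy≡true (sym gx≡true))
    ... | inj₁ y≡x  = y≡x
    ... | inj₂ refl = contradiction (trans (sym gy≡true) g∁x) λ ()

pair-⊥-sensitiveAt : {b : Vec Bool n} → k < ∣ b ∣ → SensitiveAt k (pair ⊥ b) ⊥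
pair-⊥-sensitiveAt {n} {k} {b} k<∣b∣ S 1≤∣S∣ ∣S∣≤k same-value =
  contradiction (trans (sym at-⊥) (trans same-value (trans (cong (pair ⊥ b) (flipAt-⊥ S)) at-S))) λ ()
  where
  at-⊥ : pair ⊥ b ⊥ ≡ true
  at-⊥ = cong (_∨ point b ⊥) (dec-true (⊥ {n} ≟ ⊥) refl)
  ⊥≢S : ⊥ ≢ S
  ⊥≢S ⊥≡S = <⇒≢ 1≤∣S∣ (sym (trans (cong ∣_∣ (sym ⊥≡S)) (∣⊥∣≡0 n)))
  b≢S : b ≢ S
  b≢S b≡S = ≤⇒≯ ∣S∣≤k (subst (λ T → k < ∣ T ∣) b≡S k<∣b∣)
  at-S : pair ⊥ b S ≡ false
  at-S = cong₂ _∨_ (dec-false (⊥ ≟ S) ⊥≢S) (dec-false (b ≟ S) b≢S)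

pair-⊥-sensitive∧degLessThan : (b : Vec Bool n) → ⊥ ≢ b → sign b ≡ opposite (sign (⊥ {n})) → k < ∣ b ∣ →
  KthOrderSensitive k (pair ⊥ b) × DegLessThan (pair ⊥ b) n
pair-⊥-sensitive∧degLessThan b ⊥≢b opposite-signs k<∣b∣ =
  (⊥ , pair-⊥-sensitiveAt {b = b} k<∣b∣) , balanced⇒degLessThan {f = pair ⊥ b} (pair-balanced ⊥≢b opposite-signs)

%2≡0 : ∀ n → parity n ≡ 0ℙ → n % 2 ≡ 0
%2≡0 zero          _    = refl
%2≡0 (suc (suc n)) even = %2≡0 n even

%2≡1 : ∀ n → parity n ≡ 1ℙ → n % 2 ≡ 1
%2≡1 (suc zero)    _   = refl
%2≡1 (suc (suc n)) odd = %2≡1 n odd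

maxOrder-even : ∀ n → parity n ≡ 0ℙ → maxOrder n ≡ n ∸ 2
maxOrder-even n even with n % 2 | %2≡0 n even
... | .0 | refl = refl

maxOrder-odd : ∀ n → parity n ≡ 1ℙ → maxOrder n ≡ n ∸ 1
maxOrder-odd n odd with n % 2 | %2≡1 n odd
... | .1 | refl = refl

mainTheorem8 : (n : ℕ) → 2 ≤ n →
    (∃ λ (f : BoolFun n) → KthOrderSensitive (maxOrder n) f × DegLessThan f n)
    × (∀ (k : ℕ) (f : BoolFun n) → KthOrderSensitive k f → DegLessThan f n → k ≤ maxOrder n)
mainTheorem8 zero ()
mainTheorem8 (suc zero) (s≤s ())
mainTheorem8 (suc (suc m)) _ with parity m in parity-m
... | 0ℙ rewrite maxOrder-even (suc (suc m)) parity-m =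
      (pair ⊥ (false ∷ ⊤) , pair-⊥-sensitive∧degLessThan (false ∷ ⊤) (λ ()) (cong opposite sign-⊤≡sign-⊥) m<∣⊤∣)
    , λ k f (x , sensitive) deg → sensitiveAt∧balanced⇒k≤n-even parity-m {f} sensitive (degLessThan⇒balanced {f = f} deg)
  where
  sign-⊤≡sign-⊥ : sign (⊤ {suc m}) ≡ sign (⊥ {suc (suc m)})
  sign-⊤≡sign-⊥ = trans (sign-⊤ (suc m)) (sym (trans (sign-⊥ (suc (suc m))) (cong toSign parity-m)))
  m<∣⊤∣ : m < ∣ ⊤ {suc m} ∣
  m<∣⊤∣ = ≤-reflexive (sym (∣⊤∣≡n (suc m)))
... | 1ℙ rewrite maxOrder-odd (suc (suc m)) parity-m =
      (pair ⊥ ⊤ , pair-⊥-sensitive∧degLessThan ⊤ (λ ()) sign-⊤≡opposite 1+m<∣⊤∣)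
    , λ k f (x , sensitive) deg → sensitiveAt∧balanced⇒k≤n {f = f} sensitive (degLessThan⇒balanced {f = f} deg)
  where
  sign-⊤≡opposite : sign (⊤ {suc (suc m)}) ≡ opposite (sign (⊥ {suc (suc m)}))
  sign-⊤≡opposite = trans (sign-⊤ (suc (suc m))) (cong opposite (sym (trans (sign-⊥ (suc (suc m))) (cong toSign parity-m))))
  1+m<∣⊤∣ : suc m < ∣ ⊤ {suc (suc m)} ∣
  1+m<∣⊤∣ = ≤-reflexive (sym (∣⊤∣≡n (suc (suc m))))
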